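{- Let $\Phi$ be a derivation in the CbNeed type system of $\Gamma\vdash^{(m,e)} s:M$ with $M\neq\mathbf 0$. (1) If $t\to_{m,\mathrm{need}} s$ then there is a derivation of $\Gamma\vdash^{(m+1,e)} t:M$. (2) If $t\to_{e,\mathrm{need}} s$ then there is a derivation of $\Gamma\vdash^{(m,e+1)} t:M$.
   Context: Terms: $t,s ::= x \mid \lambda x.t \mid t\,s \mid t[x\leftarrow s]$, where $t[x\leftarrow s]$ (explicit substitution) binds $x$ in $t$; values $v ::= \lambda x.t$; usual free variables, terms up to $\alpha$-equivalence. Contexts: substitution contexts $S ::= \langle\cdot\rangle \mid S[x\leftarrow t]$; CbNeed contexts $E ::= \langle\cdot\rangle \mid E\,t \mid E[x\leftarrow t] \mid E\langle\langle x\rangle\rangle[x\leftarrow E']$; $E\langle t\rangle$ plugging (may capture), $E\langle\langle t\rangle\rangle$ plugging where $E$ does not capture free variables of $t$. Root steps: $S\langle\lambda x.t\rangle s\mapsto_m S\langle t[x\leftarrow s]\rangle$ (variables bound by $S$ disjoint from $\mathrm{fv}(s)$); $E\langle\langle x\rangle\rangle[x\leftarrow S\langle v\rangle]\mapsto_e S\langle E\langle\langle v\rangle\rangle[x\leftarrow v]\rangle$ (variables bound by $S$ disjoint from $\mathrm{fv}(E\langle\langle x\rangle\rangle)$). $\to_{m,\mathrm{need}}$ (resp. $\to_{e,\mathrm{need}}$) relates $E\langle t'\rangle$ to $E\langle s'\rangle$ for any CbNeed context $E$ when $t'\mapsto_m s'$ (resp. $\mapsto_e$). CbNeed types: linear types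 $L ::= \mathsf{normal}\mid M\to N$; multi types $M,N ::= [L_i]_{i\in J}$ finite multisets, $\mathbf 0$ empty multiset, $\uplus$ union. Type contexts $\Gamma$ map variables to multi types, all but finitely many to $\mathbf 0$; $\mathrm{dom}(\Gamma)=\{x\mid\Gamma(x)\ne\mathbf 0\}$; $\uplus$ pointwise; $\Gamma,x:M$ means $\Gamma\uplus(x\mapsto M)$ with $x\notin\mathrm{dom}(\Gamma)$. Rules: (ax) $x:M\vdash^{(0,1)} x:M$ (with $M\neq\mathbf 0$); (normal) $\vdash^{(0,0)}\lambda x.t:\mathsf{normal}$; (fun) from $\Gamma,x:M\vdash^{(m,e)} t:N$ infer $\Gamma\vdash^{(m,e)}\lambda x.t:M\to N$; (many) from $\Gamma_i\vdash^{(m_i,e_i)}\lambda x.t:L_i$, $i\in J$, $J\neq\emptyset$, infer $\biguplus_i\Gamma_i\vdash^{(\sum m_i,\sum e_i)}\lambda x.t:[L_i]_{i\in J}$; (app$_{gc}$) from $\Gamma\vdash^{(m,e)} t:[\mathbf 0\to M]$ infer $\Gamma\vdash^{(m+1,e)} t\,s:M$; (app) from $\Gamma\vdash^{(m,e)} t:[N\to M]$ and $\Pi\vdash^{(m',e')} s:N$ with $N\ne\mathbf 0$ infer $\Gamma\uplus\Pi\vdash^{(m+m'+1,e+e')} t\,s:M$; (ES$_{gc}$) from $\Gamma\vdash^{(m,e)} t:M$ with $\Gamma(x)=\mathbf 0$ infer $\Gamma\vdash^{(m,e)} t[x\leftarrow s]:M$; (ES) from $\Gamma,x:N\vdash^{(m,e)}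 t:M$ and $\Pi\vdash^{(m',e')} s:N$ with $N\ne\mathbf 0$ infer $\Gamma\uplus\Pi\vdash^{(m+m',e+e')} t[x\leftarrow s]:M$. -}

module Defs where

open import Data.Nat using (ℕ; zero; suc; _+_; _≟_)
open import Data.List using (List; []; _∷_; [_]; _++_)
open import Data.List.Membership.Propositional using (_∈_)
open import Data.List.Relation.Binary.Permutation.Homogeneous using (Permutation)
open import Data.Bool using (if_then_else_)
open import Relation.Nullary using (¬_)
open import Relation.Nullary.Decidable using (⌊_⌋)
open import Relation.Binary.PropositionalEquality using (_≡_; _≢_)
open import Data.Product using (_×_; Σ; ∃; _,_)

Var : Set
Var = ℕ

data Term : Set where
  var : Var → Term
  lam : Var → Term → Term
  app : Term → Term → Term
  es  : Term → Var → Term → Term     -- t[x←s], binds x in t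

data Value : Term → Set where
  lamV : ∀ x t → Value (lam x t)

data _∈FV_ (x : Var) : Term → Set where
  fv-var  : x ∈FV var x
  fv-lam  : ∀ {y t} → x ≢ y → x ∈FV t → x ∈FV lam y t
  fv-appˡ : ∀ {t s} → x ∈FV t → x ∈FV app t s
  fv-appʳ : ∀ {t s} → x ∈FV s → x ∈FV app t s
  fv-esˡ  : ∀ {t y s} → x ≢ y → x ∈FV t → x ∈FV es t y s
  fv-esʳ  : ∀ {t y s} → x ∈FV s → x ∈FV es t y s

data SCtx : Set where
  hole : SCtx
  sub  : SCtx → Var → Term → SCtx

_⟨_⟩ˢ : SCtx → Term → Term
hole      ⟨ u ⟩ˢ = u
sub S x t ⟨ u ⟩ˢ = es (S ⟨ u ⟩ˢ) x t

bvS : SCtx → List Var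
bvS hole        = []
bvS (sub S x t) = x ∷ bvS S

data NCtx : Set where
  hole  : NCtx
  appC  : NCtx → Term → NCtx
  subC  : NCtx → Var → Term → NCtx
  needC : NCtx → Var → NCtx → NCtx     -- E⟨⟨x⟩⟩[x←E']

-- plugging (may capture)
_⟨_⟩ : NCtx → Term → Term
hole        ⟨ u ⟩ = u
appC E t    ⟨ u ⟩ = app (E ⟨ u ⟩) t
subC E x t  ⟨ u ⟩ = es (E ⟨ u ⟩) x t
needC E x E' ⟨ u ⟩ = es (E ⟨ var x ⟩) x (E' ⟨ u ⟩)

capt : NCtx → List Var
capt hole          = []
capt (appC E t)    = capt E
capt (subC E x t)  = x ∷ capt E
capt (needC E x E') = capt E'

-- E does not capture free variables of t (so that E⟨⟨t⟩⟩ is defined)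
NoCapture : NCtx → Term → Set
NoCapture E t = ∀ y → y ∈ capt E → ¬ (y ∈FV t)

data IsNeedCtx : NCtx → Set where
  hole  : IsNeedCtx hole
  appC  : ∀ {E t} → IsNeedCtx E → IsNeedCtx (appC E t)
  subC  : ∀ {E x t} → IsNeedCtx E → IsNeedCtx (subC E x t)
  needC : ∀ {E x E'} → IsNeedCtx E → NoCapture E (var x) → IsNeedCtx E'
        → IsNeedCtx (needC E x E')

data _↦m_ : Term → Term → Set where
  root-m : ∀ S x t s
         → (∀ y → y ∈ bvS S → ¬ (y ∈FV s))
         → app (S ⟨ lam x t ⟩ˢ) s ↦m (S ⟨ es t x s ⟩ˢ)

-- E⟨⟨x⟩⟩[x←S⟨v⟩] ↦e S⟨E⟨⟨v⟩⟩[x←v]⟩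
--   (bv(S) ∩ fv(E⟨⟨x⟩⟩) = ∅; E⟨⟨x⟩⟩, E⟨⟨v⟩⟩ capture-free;
--    Barendregt convention: the bound x is not free in v)
data _↦e_ : Term → Term → Set where
  root-e : ∀ E x S v
         → IsNeedCtx E
         → Value v
         → NoCapture E (var x)
         → NoCapture E v
         → ¬ (x ∈FV v)
         → (∀ y → y ∈ bvS S → ¬ (y ∈FV (E ⟨ var x ⟩)))
         → es (E ⟨ var x ⟩) x (S ⟨ v ⟩ˢ) ↦e (S ⟨ es (E ⟨ v ⟩) x v ⟩ˢ)

_→m-need_ : Term → Term → Set
t →m-need s = Σ NCtx λ E → IsNeedCtx E × ∃ λ t' → ∃ λ s' →
  (t ≡ E ⟨ t' ⟩) × (s ≡ E ⟨ s' ⟩) × (t' ↦m s')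

_→e-need_ : Term → Term → Set
t →e-need s = Σ NCtx λ E → IsNeedCtx E × ∃ λ t' → ∃ λ s' →
  (t ≡ E ⟨ t' ⟩) × (s ≡ E ⟨ s' ⟩) × (t' ↦e s')

-- CbNeed types.  Multisets are lists up to (deep) permutation.

infixr 7 _⇒_
data LType : Set where
  normal : LType
  _⇒_    : List LType → List LType → LType

MType : Set
MType = List LType

𝟎 : MType
𝟎 = []

data _≈L_ : LType → LType → Set where
  normal : normal ≈L normal
  arr    : ∀ {M M' N N'} → Permutation _≈L_ M M' → Permutation _≈L_ N N'
         → (M ⇒ N) ≈L (M' ⇒ N')

_≈M_ : MType → MType → Set
M ≈M N = Permutation _≈L_ M N

Ctx : Set
Ctx = Var → MType

∅ : Ctx
∅ _ = 𝟎

_⊎_ : Ctx → Ctx → Ctx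
(Γ ⊎ Δ) y = Γ y ++ Δ y

_↦_ : Var → MType → Ctx
(x ↦ M) y = if ⌊ y ≟ x ⌋ then M else 𝟎

_≈C_ : Ctx → Ctx → Set
Γ ≈C Δ = ∀ y → Γ y ≈M Δ y

-- Typing rules.  Contexts in conclusions are taken up to ≈C
-- (contexts are functions into multisets).

infix 4 _⊢ˡ[_,_]_∶_ _⊢[_,_]_∶_

data _⊢ˡ[_,_]_∶_ : Ctx → ℕ → ℕ → Term → LType → Set
data Many : Ctx → ℕ → ℕ → Term → MType → Set
data _⊢[_,_]_∶_ : Ctx → ℕ → ℕ → Term → MType → Set

data _⊢ˡ[_,_]_∶_ where
  normal : ∀ {Γ x t} → Γ ≈C ∅ → Γ ⊢ˡ[ 0 , 0 ] lam x t ∶ normal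
  fun    : ∀ {Γ Δ x t m e M N}
         → Δ ⊢[ m , e ] t ∶ N
         → Γ x ≡ 𝟎
         → Δ ≈C (Γ ⊎ (x ↦ M))
         → Γ ⊢ˡ[ m , e ] lam x t ∶ (M ⇒ N)

-- the non-empty family of premises of rule (many)
data Many where
  one  : ∀ {Γ m e t L} → Γ ⊢ˡ[ m , e ] t ∶ L → Many Γ m e t [ L ]
  cons : ∀ {Γ Γ₁ Γ₂ m₁ e₁ m₂ e₂ t L Ls}
       → Γ₁ ⊢ˡ[ m₁ , e₁ ] t ∶ L
       → Many Γ₂ m₂ e₂ t Ls
       → Γ ≈C (Γ₁ ⊎ Γ₂)
       → Many Γ (m₁ + m₂) (e₁ + e₂) t (L ∷ Ls)

data _⊢[_,_]_∶_ where
  ax     : ∀ {Γ x M} → M ≢ 𝟎 → Γ ≈C (x ↦ M) → Γ ⊢[ 0 , 1 ] var x ∶ M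
  many   : ∀ {Γ m e x t Ls} → Many Γ m e (lam x t) Ls → Γ ⊢[ m , e ] lam x t ∶ Ls
  app-gc : ∀ {Γ m e t s M}
         → Γ ⊢[ m , e ] t ∶ [ 𝟎 ⇒ M ]
         → Γ ⊢[ suc m , e ] app t s ∶ M
  app    : ∀ {Γ Γ₁ Π m e m' e' t s M N}
         → Γ₁ ⊢[ m , e ] t ∶ [ N ⇒ M ]
         → Π ⊢[ m' , e' ] s ∶ N
         → N ≢ 𝟎
         → Γ ≈C (Γ₁ ⊎ Π)
         → Γ ⊢[ m + m' + 1 , e + e' ] app t s ∶ M
  es-gc  : ∀ {Γ m e t x s M}
         → Γ ⊢[ m , e ] t ∶ M
         → Γ x ≡ 𝟎
         → Γ ⊢[ m , e ] es t x s ∶ M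
  es     : ∀ {Γ Γ₀ Δ Π m e m' e' t x s M N}
         → Δ ⊢[ m , e ] t ∶ M
         → Π ⊢[ m' , e' ] s ∶ N
         → N ≢ 𝟎
         → Γ₀ x ≡ 𝟎
         → Δ ≈C (Γ₀ ⊎ (x ↦ N))
         → Γ ≈C (Γ₀ ⊎ Π)
         → Γ ⊢[ m + m' , e + e' ] es t x s ∶ M

module Submission where

-- The proof has three layers.
--  * Bookkeeping: multiset and context equality, removal of a binding, and
--    the two structural facts about typings: relevance (a variable that is
--    not free has type 𝟎) and merging of two derivations of an abstraction.
--  * Decomposition: a derivation of E⟨u⟩, for a CbNeed context E not
--    capturing u, splits into a derivation of u : L and a derivation of E
--    into which any other term of type L can be replugged.  Consequently a
--    variable in needed position has non-empty type, which makes the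
--    garbage-collection rule impossible in a context E⟨⟨x⟩⟩[x←E'], and
--    derivations can be transported through any CbNeed context.
--  * Root steps: β-expansion and the exponential expansion
--    E⟨v⟩[x←v] ⇝ E⟨x⟩[x←v] (replug an axiom, merge the two copies of v),
--    after commuting the substitution context S out of the redex.
-- The theorem is then closure of the root expansions under CbNeed contexts.

open import Defs
open import Data.Nat using (ℕ; suc; _+_; _≟_)
open import Data.Nat.Properties using (+-assoc; +-comm; +-suc; +-identityʳ)
open import Data.Nat.Tactic.RingSolver using (solve-∀)
open import Data.List using ([]; _∷_; [_]; _++_)
open import Data.List.Properties using (++-assoc; ++-identityʳ; ++-conicalˡ; ++-conicalʳ)
open import Data.List.Relation.Binary.Pointwise using (Pointwise; []; _∷_)
open import Data.List.Relation.Binary.Permutation.Homogeneous using (refl; prep; swap; trans)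
open import Data.List.Membership.Propositional using (_∈_)
open import Data.List.Relation.Unary.Any using (here; there)
open import Data.Product using (_×_; _,_; proj₁; proj₂)
open import Data.Empty using (⊥-elim)
open import Function using (_∘_)
open import Relation.Nullary using (¬_; yes; no)
open import Relation.Binary.Bundles using (Setoid)
open import Relation.Binary.PropositionalEquality as Eq using (_≡_; _≢_; cong; cong₂)

mutual
  ≈L-refl : ∀ L → L ≈L L
  ≈L-refl normal  = normal
  ≈L-refl (M ⇒ N) = arr (refl (pointwise-refl M)) (refl (pointwise-refl N))

  pointwise-refl : ∀ M → Pointwise _≈L_ M M
  pointwise-refl []      = []
  pointwise-refl (L ∷ M) = ≈L-refl L ∷ pointwise-refl M

mutual
  ≈L-sym : ∀ {L L'} → L ≈L L' → L' ≈L L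
  ≈L-sym normal    = normal
  ≈L-sym (arr p q) = arr (≈M-sym p) (≈M-sym q)

  ≈M-sym : ∀ {M N} → M ≈M N → N ≈M M
  ≈M-sym (refl pw)     = refl (pointwise-sym pw)
  ≈M-sym (prep r p)    = prep (≈L-sym r) (≈M-sym p)
  ≈M-sym (swap r r' p) = swap (≈L-sym r') (≈L-sym r) (≈M-sym p)
  ≈M-sym (trans p q)   = trans (≈M-sym q) (≈M-sym p)

  pointwise-sym : ∀ {M N} → Pointwise _≈L_ M N → Pointwise _≈L_ N M
  pointwise-sym []       = []
  pointwise-sym (r ∷ pw) = ≈L-sym r ∷ pointwise-sym pw

≈L-trans : ∀ {L L' L''} → L ≈L L' → L' ≈L L'' → L ≈L L''
≈L-trans normal    normal      = normal
≈L-trans (arr p q) (arr p' q') = arr (trans p p') (trans q q')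

-- ≈M is exactly the permutation relation over this setoid, so the library's
-- permutation lemmas apply to it.
≈L-setoid : Setoid _ _
≈L-setoid = record
  { Carrier       = LType
  ; _≈_           = _≈L_
  ; isEquivalence = record { refl = ≈L-refl _ ; sym = ≈L-sym ; trans = ≈L-trans }
  }

import Data.List.Relation.Binary.Permutation.Setoid.Properties ≈L-setoid as Perm

≈M-refl : ∀ {M} → M ≈M M
≈M-refl {M} = refl (pointwise-refl M)

≈M-trans : ∀ {M N K} → M ≈M N → N ≈M K → M ≈M K
≈M-trans = trans

≡⇒≈M : ∀ {M N} → M ≡ N → M ≈M N
≡⇒≈M Eq.refl = ≈M-refl

≈M-𝟎 : ∀ {M N} → M ≈M N → M ≡ 𝟎 → N ≡ 𝟎
≈M-𝟎 {N = []}    _ _       = Eq.refl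
≈M-𝟎 {N = _ ∷ _} p Eq.refl = ⊥-elim (Perm.¬x∷xs↭[] (≈M-sym p))

≈C-refl : ∀ {Γ} → Γ ≈C Γ
≈C-refl _ = ≈M-refl

≈C-sym : ∀ {Γ Δ} → Γ ≈C Δ → Δ ≈C Γ
≈C-sym p y = ≈M-sym (p y)

≈C-trans : ∀ {Γ Δ Θ} → Γ ≈C Δ → Δ ≈C Θ → Γ ≈C Θ
≈C-trans p q y = ≈M-trans (p y) (q y)

⊎-cong : ∀ {Γ Γ' Δ Δ'} → Γ ≈C Γ' → Δ ≈C Δ' → (Γ ⊎ Δ) ≈C (Γ' ⊎ Δ')
⊎-cong p q y = Perm.++⁺ (p y) (q y)

⊎-comm : ∀ Γ Δ → (Γ ⊎ Δ) ≈C (Δ ⊎ Γ)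
⊎-comm Γ Δ y = Perm.++-comm (Γ y) (Δ y)

⊎-assoc : ∀ Γ Δ Θ → ((Γ ⊎ Δ) ⊎ Θ) ≈C (Γ ⊎ (Δ ⊎ Θ))
⊎-assoc Γ Δ Θ y = ≡⇒≈M (++-assoc (Γ y) (Δ y) (Θ y))

⊎-exchange : ∀ Γ Δ Θ → ((Γ ⊎ Δ) ⊎ Θ) ≈C ((Γ ⊎ Θ) ⊎ Δ)
⊎-exchange Γ Δ Θ =
  ≈C-trans (⊎-assoc Γ Δ Θ)
    (≈C-trans (⊎-cong (≈C-refl {Γ}) (⊎-comm Δ Θ)) (≈C-sym (⊎-assoc Γ Θ Δ)))

split-𝟎 : ∀ {M A B} → M ≈M (A ++ B) → M ≡ 𝟎 → A ≡ 𝟎 × B ≡ 𝟎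
split-𝟎 {A = A} {B} p z = ++-conicalˡ A B z' , ++-conicalʳ A B z'
  where
  z' : A ++ B ≡ 𝟎
  z' = ≈M-𝟎 p z

join-𝟎 : ∀ {M A B} → M ≈M (A ++ B) → A ≡ 𝟎 → B ≡ 𝟎 → M ≡ 𝟎
join-𝟎 p z₁ z₂ = ≈M-𝟎 (≈M-sym p) (cong₂ _++_ z₁ z₂)

↦-self : ∀ x M → (x ↦ M) x ≡ M
↦-self x M with x ≟ x
... | yes _  = Eq.refl
... | no x≢x = ⊥-elim (x≢x Eq.refl)

↦-other : ∀ {x y} M → y ≢ x → (x ↦ M) y ≡ 𝟎
↦-other {x} {y} M y≢x with y ≟ x
... | yes y≡x = ⊥-elim (y≢x y≡x)
... | no _    = Eq.refl

⊎-↦𝟎 : ∀ Γ x → Γ ≈C (Γ ⊎ (x ↦ 𝟎))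
⊎-↦𝟎 Γ x y with y ≟ x
... | yes _ = ≡⇒≈M (Eq.sym (++-identityʳ (Γ y)))
... | no _  = ≡⇒≈M (Eq.sym (++-identityʳ (Γ y)))

_∖_ : Ctx → Var → Ctx
(Γ ∖ y) w with w ≟ y
... | yes _ = 𝟎
... | no _  = Γ w

∖-self : ∀ Γ y → (Γ ∖ y) y ≡ 𝟎
∖-self Γ y with y ≟ y
... | yes _  = Eq.refl
... | no y≢y = ⊥-elim (y≢y Eq.refl)

-- This is how substitutions are permuted.
extract-binding : ∀ {Δ Γ₀ Γ₁ Π y N}
  → Δ ≈C (Γ₀ ⊎ (y ↦ N)) → Γ₀ y ≡ 𝟎 → Δ ≈C (Γ₁ ⊎ Π) → Π y ≡ 𝟎
  → (Γ₁ ≈C ((Γ₁ ∖ y) ⊎ (y ↦ N))) × (Γ₀ ≈C ((Γ₁ ∖ y) ⊎ Π))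
extract-binding {Γ₀ = Γ₀} {Γ₁} {Π} {y} {N} p z₀ q zΠ = binding-in-Γ₁ , rest
  where
  binding-in-Γ₁ : Γ₁ ≈C ((Γ₁ ∖ y) ⊎ (y ↦ N))
  binding-in-Γ₁ w with w ≟ y
  ... | yes Eq.refl =
    ≈M-trans (≡⇒≈M (Eq.sym (Eq.trans (cong (Γ₁ y ++_) zΠ) (++-identityʳ _))))
      (≈M-trans (≈M-sym (q y)) (≈M-trans (p y) (≡⇒≈M (cong₂ _++_ z₀ (↦-self y N)))))
  ... | no _ = ≡⇒≈M (Eq.sym (++-identityʳ _))
  rest : Γ₀ ≈C ((Γ₁ ∖ y) ⊎ Π)
  rest w with w ≟ y
  ... | yes Eq.refl = ≡⇒≈M (Eq.trans z₀ (Eq.sym zΠ))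
  ... | no w≢y =
    ≈M-trans (≡⇒≈M (Eq.sym (Eq.trans (cong (Γ₀ w ++_) (↦-other N w≢y)) (++-identityʳ _))))
      (≈M-trans (≈M-sym (p w)) (q w))

add-to-binding : ∀ {Γ x N} L → Γ ≈C ((Γ ∖ x) ⊎ (x ↦ N))
  → (Γ ⊎ (x ↦ L)) ≈C ((Γ ∖ x) ⊎ (x ↦ (L ++ N)))
add-to-binding {Γ} {x} {N} L p w with w ≟ x
... | yes Eq.refl =
  ≈M-trans (Perm.++⁺ (≈M-trans (p x) (≡⇒≈M (cong₂ _++_ (∖-self Γ x) (↦-self x N)))) (≈M-refl {L}))
    (Perm.++-comm N L)
... | no _ = ≈M-refl

+-right-comm : ∀ a b c → a + b + c ≡ a + c + b
+-right-comm = solve-∀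

+-right-comm-1 : ∀ a b c → a + b + c + 1 ≡ a + c + 1 + b
+-right-comm-1 = solve-∀

+-left-comm : ∀ a b c → a + (b + c) ≡ b + (a + c)
+-left-comm = solve-∀

+-assoc-1 : ∀ a b c → a + b + c + 1 ≡ a + (b + c + 1)
+-assoc-1 = solve-∀

cast : ∀ {Γ m e m' e' t M} → m ≡ m' → e ≡ e' → Γ ⊢[ m , e ] t ∶ M → Γ ⊢[ m' , e' ] t ∶ M
cast Eq.refl Eq.refl D = D

cast-many : ∀ {Γ m e m' e' t M} → m ≡ m' → e ≡ e' → Many Γ m e t M → Many Γ m' e' t M
cast-many Eq.refl Eq.refl D = D

mutual
  relevance : ∀ {Γ m e t M y} → Γ ⊢[ m , e ] t ∶ M → ¬ (y ∈FV t) → Γ y ≡ 𝟎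
  relevance {y = y} (ax {x = x} _ eq) y∉ with y ≟ x
  ... | yes Eq.refl = ⊥-elim (y∉ fv-var)
  ... | no y≢x      = ≈M-𝟎 (≈M-sym (eq y)) (↦-other _ y≢x)
  relevance (many D)          y∉ = relevance-many D y∉
  relevance (app-gc D)        y∉ = relevance D (y∉ ∘ fv-appˡ)
  relevance {y = y} (app D Ds _ eq) y∉ =
    join-𝟎 (eq y) (relevance D (y∉ ∘ fv-appˡ)) (relevance Ds (y∉ ∘ fv-appʳ))
  relevance {y = y} (es-gc {x = x} D z) y∉ with y ≟ x
  ... | yes Eq.refl = z
  ... | no y≢x      = relevance D (y∉ ∘ fv-esˡ y≢x)
  relevance {y = y} (es {Γ₀ = Γ₀} {x = x} D Ds _ z eq₁ eq₂) y∉ =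
    join-𝟎 (eq₂ y) body (relevance Ds (y∉ ∘ fv-esʳ))
    where
    body : Γ₀ y ≡ 𝟎
    body with y ≟ x
    ... | yes Eq.refl = z
    ... | no y≢x      = proj₁ (split-𝟎 (eq₁ y) (relevance D (y∉ ∘ fv-esˡ y≢x)))

  relevance-many : ∀ {Γ m e t M y} → Many Γ m e t M → ¬ (y ∈FV t) → Γ y ≡ 𝟎
  relevance-many (one D)       y∉ = relevanceˡ D y∉
  relevance-many {y = y} (cons D Ds eq) y∉ = join-𝟎 (eq y) (relevanceˡ D y∉) (relevance-many Ds y∉)

  relevanceˡ : ∀ {Γ m e t L y} → Γ ⊢ˡ[ m , e ] t ∶ L → ¬ (y ∈FV t) → Γ y ≡ 𝟎
  relevanceˡ {y = y} (normal eq) _ = ≈M-𝟎 (≈M-sym (eq y)) Eq.refl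
  relevanceˡ {y = y} (fun {x = x} D z eq) y∉ with y ≟ x
  ... | yes Eq.refl = z
  ... | no y≢x      = proj₁ (split-𝟎 (eq y) (relevance D (y∉ ∘ fv-lam y≢x)))

var-in-domain : ∀ {Γ m e y M} → Γ ⊢[ m , e ] var y ∶ M → Γ y ≢ 𝟎
var-in-domain {y = y} (ax {M = M} M≢𝟎 eq) z =
  M≢𝟎 (Eq.trans (Eq.sym (↦-self y M)) (≈M-𝟎 (eq y) z))

bound-in-domain : ∀ {Δ Γ₀ x N} → N ≢ 𝟎 → Δ ≈C (Γ₀ ⊎ (x ↦ N)) → Δ x ≢ 𝟎
bound-in-domain {x = x} {N} N≢𝟎 eq z =
  N≢𝟎 (Eq.trans (Eq.sym (↦-self x N)) (proj₂ (split-𝟎 (eq x) z)))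

-- Values only receive non-empty multi types (rule many has a premise).
value-type-nonempty : ∀ {Γ m e v L} → Value v → Γ ⊢[ m , e ] v ∶ L → L ≢ 𝟎
value-type-nonempty (lamV _ _) (many (one _))      ()
value-type-nonempty (lamV _ _) (many (cons _ _ _)) ()

merge-many : ∀ {Γ Γ' m e m' e' t Ls Ns} → Many Γ m e t Ls → Many Γ' m' e' t Ns
  → Many (Γ ⊎ Γ') (m + m') (e + e') t (Ls ++ Ns)
merge-many (one D) B = cons D B ≈C-refl
merge-many {Γ' = Γ'} {m' = m'} {e' = e'}
  (cons {Γ₁ = Γ₁} {Γ₂} {m₁} {e₁} {m₂} {e₂} D A eq) B =
  cast-many (Eq.sym (+-assoc m₁ m₂ m')) (Eq.sym (+-assoc e₁ e₂ e'))
    (cons D (merge-many A B) (≈C-trans (⊎-cong eq (≈C-refl {Γ'})) (⊎-assoc Γ₁ Γ₂ Γ')))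

merge : ∀ {Γ Γ' m e m' e' x t L N} → Γ ⊢[ m , e ] lam x t ∶ L → Γ' ⊢[ m' , e' ] lam x t ∶ N
  → (Γ ⊎ Γ') ⊢[ m + m' , e + e' ] lam x t ∶ (L ++ N)
merge (many A) (many B) = many (merge-many A B)

-- A derivation of E⟨u⟩ seen as a derivation of u : L in Γᵘ plugged into a
-- derivation of the context E in Γᴱ; the context part accepts any other
-- term of type L whose context avoids the variables captured by E.
record Decomposition (E : NCtx) (Γ : Ctx) (m e : ℕ) (u : Term) (M : MType) : Set where
  field
    Γᴱ Γᵘ           : Ctx
    L               : MType
    mᴱ eᴱ mᵘ eᵘ     : ℕ
    hole-derivation : Γᵘ ⊢[ mᵘ , eᵘ ] u ∶ L
    context-split   : Γ ≈C (Γᴱ ⊎ Γᵘ)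
    m-split         : m ≡ mᴱ + mᵘ
    e-split         : e ≡ eᴱ + eᵘ
    replug          : ∀ {Θ u' m' e'} → (∀ z → z ∈ capt E → Θ z ≡ 𝟎)
                    → Θ ⊢[ m' , e' ] u' ∶ L → (Γᴱ ⊎ Θ) ⊢[ mᴱ + m' , eᴱ + e' ] E ⟨ u' ⟩ ∶ M

decompose-hole : ∀ {Γ m e u M} → Γ ⊢[ m , e ] u ∶ M → Decomposition hole Γ m e u M
decompose-hole {Γ} {m} {e} {M = M} D = record
  { Γᴱ = ∅ ; Γᵘ = Γ ; L = M ; mᴱ = 0 ; eᴱ = 0 ; mᵘ = m ; eᵘ = e
  ; hole-derivation = D ; context-split = ≈C-refl ; m-split = Eq.refl ; e-split = Eq.refl
  ; replug = λ _ D' → D' }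

decompose-app-gc : ∀ {E Γ m e u s M}
  → Decomposition E Γ m e u [ 𝟎 ⇒ M ] → Decomposition (appC E s) Γ (suc m) e u M
decompose-app-gc d = record
  { Γᴱ = Γᴱ ; Γᵘ = Γᵘ ; L = L ; mᴱ = suc mᴱ ; eᴱ = eᴱ ; mᵘ = mᵘ ; eᵘ = eᵘ
  ; hole-derivation = hole-derivation ; context-split = context-split
  ; m-split = cong suc m-split ; e-split = e-split
  ; replug = λ c D' → app-gc (replug c D') }
  where open Decomposition d

decompose-app : ∀ {E Γ Γ₁ Π m e m' e' u s M N}
  → Decomposition E Γ₁ m e u [ N ⇒ M ] → Π ⊢[ m' , e' ] s ∶ N → N ≢ 𝟎 → Γ ≈C (Γ₁ ⊎ Π)
  → Decomposition (appC E s) Γ (m + m' + 1) (e + e') u M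
decompose-app {Π = Π} {m' = m'} {e' = e'} d Ds N≢𝟎 eq = record
  { Γᴱ = Γᴱ ⊎ Π ; Γᵘ = Γᵘ ; L = L ; mᴱ = mᴱ + m' + 1 ; eᴱ = eᴱ + e' ; mᵘ = mᵘ ; eᵘ = eᵘ
  ; hole-derivation = hole-derivation
  ; context-split = ≈C-trans eq (≈C-trans (⊎-cong context-split (≈C-refl {Π})) (⊎-exchange Γᴱ Γᵘ Π))
  ; m-split = Eq.trans (cong (λ k → k + m' + 1) m-split) (+-right-comm-1 mᴱ mᵘ m')
  ; e-split = Eq.trans (cong (_+ e') e-split) (+-right-comm eᴱ eᵘ e')
  ; replug = λ {Θ} {_} {m''} {e''} c D' →
      cast (+-right-comm-1 mᴱ m'' m') (+-right-comm eᴱ e'' e')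
        (app (replug c D') Ds N≢𝟎 (⊎-exchange Γᴱ Π Θ)) }
  where open Decomposition d

decompose-es-gc : ∀ {E Γ m e u x s M}
  → Decomposition E Γ m e u M → Γ x ≡ 𝟎 → Decomposition (subC E x s) Γ m e u M
decompose-es-gc {x = x} d z = record
  { Γᴱ = Γᴱ ; Γᵘ = Γᵘ ; L = L ; mᴱ = mᴱ ; eᴱ = eᴱ ; mᵘ = mᵘ ; eᵘ = eᵘ
  ; hole-derivation = hole-derivation ; context-split = context-split
  ; m-split = m-split ; e-split = e-split
  ; replug = λ c D' → es-gc (replug (λ w → c w ∘ there) D')
      (cong₂ _++_ (proj₁ (split-𝟎 (context-split x) z)) (c x (here Eq.refl))) }
  where open Decomposition d

decompose-es : ∀ {E Γ Γ₀ Δ Π m e m' e' u x s M N}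
  → Decomposition E Δ m e u M → ¬ (x ∈FV u)
  → Π ⊢[ m' , e' ] s ∶ N → N ≢ 𝟎 → Γ₀ x ≡ 𝟎 → Δ ≈C (Γ₀ ⊎ (x ↦ N)) → Γ ≈C (Γ₀ ⊎ Π)
  → Decomposition (subC E x s) Γ (m + m') (e + e') u M
decompose-es {Γ₀ = Γ₀} {Π = Π} {m' = m'} {e' = e'} {x = x} {N = N} d x∉u Ds N≢𝟎 z₀ eq₁ eq₂ = record
  { Γᴱ = (Γᴱ ∖ x) ⊎ Π ; Γᵘ = Γᵘ ; L = L ; mᴱ = mᴱ + m' ; eᴱ = eᴱ + e' ; mᵘ = mᵘ ; eᵘ = eᵘ
  ; hole-derivation = hole-derivation
  ; context-split = ≈C-trans eq₂
      (≈C-trans (⊎-cong (proj₂ x-split) (≈C-refl {Π})) (⊎-exchange (Γᴱ ∖ x) Γᵘ Π))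
  ; m-split = Eq.trans (cong (_+ m') m-split) (+-right-comm mᴱ mᵘ m')
  ; e-split = Eq.trans (cong (_+ e') e-split) (+-right-comm eᴱ eᵘ e')
  ; replug = λ {Θ} {_} {m''} {e''} c D' →
      cast (+-right-comm mᴱ m'' m') (+-right-comm eᴱ e'' e')
        (es {Γ₀ = (Γᴱ ∖ x) ⊎ Θ} (replug (λ w → c w ∘ there) D') Ds N≢𝟎
          (cong₂ _++_ (∖-self Γᴱ x) (c x (here Eq.refl)))
          (≈C-trans (⊎-cong (proj₁ x-split) (≈C-refl {Θ})) (⊎-exchange (Γᴱ ∖ x) (x ↦ N) Θ))
          (⊎-exchange (Γᴱ ∖ x) Π Θ)) }
  where
  open Decomposition d
  -- x is bound by the context part only, since it is not free in u.
  x-split : (Γᴱ ≈C ((Γᴱ ∖ x) ⊎ (x ↦ N))) × (Γ₀ ≈C ((Γᴱ ∖ x) ⊎ Γᵘ))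
  x-split = extract-binding eq₁ z₀ context-split (relevance hole-derivation x∉u)

decompose-need : ∀ {E E' Γ Γ₀ Δ Π m e m' e' u x M N}
  → Δ ⊢[ m , e ] E ⟨ var x ⟩ ∶ M → Decomposition E' Π m' e' u N
  → N ≢ 𝟎 → Γ₀ x ≡ 𝟎 → Δ ≈C (Γ₀ ⊎ (x ↦ N)) → Γ ≈C (Γ₀ ⊎ Π)
  → Decomposition (needC E x E') Γ (m + m') (e + e') u M
decompose-need {Γ₀ = Γ₀} {m = m} {e = e} Dx d N≢𝟎 z₀ eq₁ eq₂ = record
  { Γᴱ = Γ₀ ⊎ Γᴱ ; Γᵘ = Γᵘ ; L = L ; mᴱ = m + mᴱ ; eᴱ = e + eᴱ ; mᵘ = mᵘ ; eᵘ = eᵘ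
  ; hole-derivation = hole-derivation
  ; context-split = ≈C-trans eq₂
      (≈C-trans (⊎-cong (≈C-refl {Γ₀}) context-split) (≈C-sym (⊎-assoc Γ₀ Γᴱ Γᵘ)))
  ; m-split = Eq.trans (cong (m +_) m-split) (Eq.sym (+-assoc m mᴱ mᵘ))
  ; e-split = Eq.trans (cong (e +_) e-split) (Eq.sym (+-assoc e eᴱ eᵘ))
  ; replug = λ {Θ} {_} {m''} {e''} c D' →
      cast (Eq.sym (+-assoc m mᴱ m'')) (Eq.sym (+-assoc e eᴱ e''))
        (es Dx (replug c D') N≢𝟎 z₀ eq₁ (⊎-assoc Γ₀ Γᴱ Θ)) }
  where open Decomposition d

-- Every derivation of E⟨u⟩ decomposes.  The garbage-collecting case of
-- E⟨⟨x⟩⟩[x←E'] is impossible because x is needed in E⟨⟨x⟩⟩, which in turn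
-- follows from decomposing E⟨⟨x⟩⟩ around x.
mutual
  decompose : ∀ {E Γ m e u M} → IsNeedCtx E → NoCapture E u
    → Γ ⊢[ m , e ] E ⟨ u ⟩ ∶ M → Decomposition E Γ m e u M
  decompose hole        _  D                          = decompose-hole D
  decompose (appC i)    nc (app-gc D)                 = decompose-app-gc (decompose i nc D)
  decompose (appC i)    nc (app D Ds N≢𝟎 eq)          = decompose-app (decompose i nc D) Ds N≢𝟎 eq
  decompose (subC i)    nc (es-gc D z)                =
    decompose-es-gc (decompose i (λ w → nc w ∘ there) D) z
  decompose (subC i)    nc (es D Ds N≢𝟎 z₀ eq₁ eq₂)   =
    decompose-es (decompose i (λ w → nc w ∘ there) D) (nc _ (here Eq.refl)) Ds N≢𝟎 z₀ eq₁ eq₂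
  decompose (needC i ncx _)  _  (es-gc D z)           = ⊥-elim (needed-in-domain i ncx D z)
  decompose (needC _ _ i')   nc (es D Ds N≢𝟎 z₀ eq₁ eq₂) =
    decompose-need D (decompose i' nc Ds) N≢𝟎 z₀ eq₁ eq₂

  needed-in-domain : ∀ {E Γ m e y M} → IsNeedCtx E → NoCapture E (var y)
    → Γ ⊢[ m , e ] E ⟨ var y ⟩ ∶ M → Γ y ≢ 𝟎
  needed-in-domain {y = y} i nc D z =
    var-in-domain hole-derivation (proj₂ (split-𝟎 {A = Γᴱ y} (context-split y) z))
    where open Decomposition (decompose i nc D)

closure : ∀ {t' s'} (a b : ℕ)
  → (∀ {Γ m e M} → Γ ⊢[ m , e ] s' ∶ M → Γ ⊢[ a + m , b + e ] t' ∶ M)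
  → ∀ {E} → IsNeedCtx E
  → ∀ {Γ m e M} → Γ ⊢[ m , e ] E ⟨ s' ⟩ ∶ M → Γ ⊢[ a + m , b + e ] E ⟨ t' ⟩ ∶ M
closure a b f hole D = f D
closure a b f (appC i) (app-gc {m = m} D) =
  cast (Eq.sym (+-suc a m)) Eq.refl (app-gc (closure a b f i D))
closure a b f (appC i) (app {m = m} {e} {m'} {e'} D Ds N≢𝟎 eq) =
  cast (+-assoc-1 a m m') (+-assoc b e e') (app (closure a b f i D) Ds N≢𝟎 eq)
closure a b f (subC i) (es-gc D z) = es-gc (closure a b f i D) z
closure a b f (subC i) (es {m = m} {e} {m'} {e'} D Ds N≢𝟎 z₀ eq₁ eq₂) =
  cast (+-assoc a m m') (+-assoc b e e') (es (closure a b f i D) Ds N≢𝟎 z₀ eq₁ eq₂)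
closure a b f (needC i nc _) (es-gc D z) = ⊥-elim (needed-in-domain i nc D z)
closure a b f (needC _ _ i') (es {m = m} {e} {m'} {e'} D Ds N≢𝟎 z₀ eq₁ eq₂) =
  cast (+-left-comm m a m') (+-left-comm e b e') (es D (closure a b f i' Ds) N≢𝟎 z₀ eq₁ eq₂)

es-assoc : ∀ {Γ m e B x C y r M} → ¬ (y ∈FV B)
  → Γ ⊢[ m , e ] es (es B x C) y r ∶ M → Γ ⊢[ m , e ] es B x (es C y r) ∶ M
es-assoc _ (es-gc (es-gc DB z) _) = es-gc DB z
es-assoc {y = y} _ (es-gc (es DB DC N≢𝟎 z₀ eq₁ eq₂) zy) =
  es DB (es-gc DC (proj₂ (split-𝟎 (eq₂ y) zy))) N≢𝟎 z₀ eq₁ eq₂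
es-assoc y∉B (es (es-gc DB _) _ N≢𝟎 _ eq₁ _) = ⊥-elim (bound-in-domain N≢𝟎 eq₁ (relevance DB y∉B))
es-assoc {y = y} y∉B
  (es {Γ₀ = Γ₀} {Π = Πr} {m' = mr} {e' = er} {N = Nr}
    (es {Γ₀ = ΓB} {Π = ΠC} {m = mB} {e = eB} {m' = mC} {e' = eC} DB DC N≢𝟎 zB eqB₁ eqB₂)
    Dr Nr≢𝟎 z₀ eq₁ eq₂) =
  cast (Eq.sym (+-assoc mB mC mr)) (Eq.sym (+-assoc eB eC er))
    (es DB (es {Γ₀ = ΠC ∖ y} DC Dr Nr≢𝟎 (∖-self ΠC y) (proj₁ y-split) ≈C-refl) N≢𝟎 zB eqB₁
      (≈C-trans eq₂ (≈C-trans (⊎-cong (proj₂ y-split) (≈C-refl {Πr}))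
        (≈C-trans (⊎-cong (⊎-comm (ΠC ∖ y) ΓB) (≈C-refl {Πr})) (⊎-assoc ΓB (ΠC ∖ y) Πr)))))
  where
  y∉ΓB : ΓB y ≡ 𝟎
  y∉ΓB = proj₁ (split-𝟎 (eqB₁ y) (relevance DB y∉B))
  y-split : (ΠC ≈C ((ΠC ∖ y) ⊎ (y ↦ Nr))) × (Γ₀ ≈C ((ΠC ∖ y) ⊎ ΓB))
  y-split = extract-binding eq₁ z₀ (≈C-trans eqB₂ (⊎-comm ΓB ΠC)) y∉ΓB

app-es-commute : ∀ {Γ m e U s y r M} → ¬ (y ∈FV s)
  → Γ ⊢[ m , e ] es (app U s) y r ∶ M → Γ ⊢[ m , e ] app (es U y r) s ∶ M
app-es-commute _ (es-gc (app-gc D) z) = app-gc (es-gc D z)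
app-es-commute {y = y} _ (es-gc (app D Ds N≢𝟎 eq) z) =
  app (es-gc D (proj₁ (split-𝟎 (eq y) z))) Ds N≢𝟎 eq
app-es-commute _ (es (app-gc D) Dr Nr≢𝟎 z₀ eq₁ eq₂) = app-gc (es D Dr Nr≢𝟎 z₀ eq₁ eq₂)
app-es-commute {y = y} y∉s
  (es {Γ₀ = Γ₀} {Π = Πr} {m' = mr} {e' = er} {N = Nr}
    (app {Γ₁ = Γ₁} {Π = Πs} {m = mU} {e = eU} {m' = ms} {e' = es'} DU Ds N≢𝟎 eq)
    Dr Nr≢𝟎 z₀ eq₁ eq₂) =
  cast (+-right-comm-1 mU mr ms) (+-right-comm eU er es')
    (app (es {Γ₀ = Γ₁ ∖ y} DU Dr Nr≢𝟎 (∖-self Γ₁ y) (proj₁ y-split) ≈C-refl) Ds N≢𝟎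
      (≈C-trans eq₂ (≈C-trans (⊎-cong (proj₂ y-split) (≈C-refl {Πr})) (⊎-exchange (Γ₁ ∖ y) Πs Πr))))
  where
  y-split : (Γ₁ ≈C ((Γ₁ ∖ y) ⊎ (y ↦ Nr))) × (Γ₀ ≈C ((Γ₁ ∖ y) ⊎ Πs))
  y-split = extract-binding eq₁ z₀ eq (relevance Ds y∉s)

β-expand : ∀ {Γ m e t x s M} → Γ ⊢[ m , e ] es t x s ∶ M → Γ ⊢[ suc m , e ] app (lam x t) s ∶ M
β-expand {Γ} {x = x} (es-gc D z) = app-gc (many (one (fun D z (⊎-↦𝟎 Γ x))))
β-expand (es {m = m} {m' = m'} D Ds N≢𝟎 z₀ eq₁ eq₂) =
  cast (+-comm (m + m') 1) Eq.refl (app (many (one (fun D z₀ eq₁))) Ds N≢𝟎 eq₂)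

-- S⟨t[x←s]⟩ expands to S⟨λx.t⟩ s: β-expand, then commute the
-- substitutions of S out of the application one at a time.
m-root-expand : ∀ S {x t s} → (∀ y → y ∈ bvS S → ¬ (y ∈FV s))
  → ∀ {Γ m e M} → Γ ⊢[ m , e ] S ⟨ es t x s ⟩ˢ ∶ M → Γ ⊢[ suc m , e ] app (S ⟨ lam x t ⟩ˢ) s ∶ M
m-root-expand hole _ D = β-expand D
m-root-expand (sub S y r) fresh D =
  app-es-commute (fresh y (here Eq.refl))
    (closure 1 0 (m-root-expand S (λ w → fresh w ∘ there)) (subC hole) D)

m-root : ∀ {t' s'} → t' ↦m s' → ∀ {Γ m e M} → Γ ⊢[ m , e ] s' ∶ M → Γ ⊢[ suc m , e ] t' ∶ M
m-root (root-m S _ _ _ fresh) = m-root-expand S fresh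

replug-variable : ∀ {E Γ m e u M x} (d : Decomposition E Γ m e u M) → NoCapture E (var x)
  → Decomposition.L d ≢ 𝟎
  → (Decomposition.Γᴱ d ⊎ (x ↦ Decomposition.L d))
      ⊢[ Decomposition.mᴱ d , suc (Decomposition.eᴱ d) ] E ⟨ var x ⟩ ∶ M
replug-variable {E} {x = x} d ncx L≢𝟎 =
  cast (+-identityʳ mᴱ) (+-comm eᴱ 1) (replug x-not-captured (ax L≢𝟎 ≈C-refl))
  where
  open Decomposition d
  x-not-captured : ∀ z → z ∈ capt E → (x ↦ L) z ≡ 𝟎
  x-not-captured z h = ↦-other L λ { Eq.refl → ncx z h fv-var }

-- E⟨v⟩[x←v] expands to E⟨⟨x⟩⟩[x←v]: decompose E⟨v⟩ around its copy of
-- v : L, replug the axiom x : L, and let the substitution type the copy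
-- of v as well (merging it with the existing type N of x, if any).
exp-core : ∀ {E x v Γ m e M} → IsNeedCtx E → Value v → NoCapture E (var x) → NoCapture E v
  → ¬ (x ∈FV v) → Γ ⊢[ m , e ] es (E ⟨ v ⟩) x v ∶ M → Γ ⊢[ m , suc e ] es (E ⟨ var x ⟩) x v ∶ M
exp-core {E} {x} {v} {Γ} {m} {e} {M} i val ncx ncv _ (es-gc D z) =
  cast (Eq.sym m-split) (cong suc (Eq.sym e-split))
    (es {Γ₀ = Γᴱ} (replug-variable d ncx L≢𝟎) hole-derivation L≢𝟎
      (proj₁ (split-𝟎 (context-split x) z)) ≈C-refl context-split)
  where
  d : Decomposition E Γ m e v M
  d = decompose i ncv D
  open Decomposition d
  L≢𝟎 : L ≢ 𝟎
  L≢𝟎 = value-type-nonempty val hole-derivation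
exp-core {E} {x} {v} {M = M} i val@(lamV _ _) ncx ncv x∉v
  (es {Γ₀ = Γ₀} {Δ} {Πv} {m} {e} {mv} {ev} {N = N} D Dv _ z₀ eq₁ eq₂) =
  cast (regroup mᴱ mᵘ mv m-split) (cong suc (regroup eᴱ eᵘ ev e-split))
    (es {Γ₀ = Γᴱ ∖ x} (replug-variable d ncx L≢𝟎) (merge hole-derivation Dv)
      (L≢𝟎 ∘ ++-conicalˡ L _) (∖-self Γᴱ x) (add-to-binding L (proj₁ x-split))
      (≈C-trans eq₂ (≈C-trans (⊎-cong (proj₂ x-split) (≈C-refl {Πv})) (⊎-assoc (Γᴱ ∖ x) Γᵘ Πv))))
  where
  d : Decomposition E Δ m e v M
  d = decompose i ncv D
  open Decomposition d
  L≢𝟎 : L ≢ 𝟎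
  L≢𝟎 = value-type-nonempty val hole-derivation
  x-split : (Γᴱ ≈C ((Γᴱ ∖ x) ⊎ (x ↦ N))) × (Γ₀ ≈C ((Γᴱ ∖ x) ⊎ Γᵘ))
  x-split = extract-binding eq₁ z₀ context-split (relevance hole-derivation x∉v)
  regroup : ∀ {n} a b c → n ≡ a + b → a + (b + c) ≡ n + c
  regroup a b c Eq.refl = Eq.sym (+-assoc a b c)

-- E⟨⟨x⟩⟩[x←S⟨v⟩] from S⟨E⟨⟨v⟩⟩[x←v]⟩: the substitutions of S are commuted
-- into the argument of [x←·] one at a time.
e-root-expand : ∀ S {A B x v} → (∀ y → y ∈ bvS S → ¬ (y ∈FV B))
  → (∀ {Γ m e M} → Γ ⊢[ m , e ] es A x v ∶ M → Γ ⊢[ m , suc e ] es B x v ∶ M)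
  → ∀ {Γ m e M} → Γ ⊢[ m , e ] S ⟨ es A x v ⟩ˢ ∶ M → Γ ⊢[ m , suc e ] es B x (S ⟨ v ⟩ˢ) ∶ M
e-root-expand hole _ core D = core D
e-root-expand (sub S y r) fresh core D =
  es-assoc (fresh y (here Eq.refl))
    (closure 0 1 (e-root-expand S (λ w → fresh w ∘ there) core) (subC hole) D)

e-root : ∀ {t' s'} → t' ↦e s' → ∀ {Γ m e M} → Γ ⊢[ m , e ] s' ∶ M → Γ ⊢[ m , suc e ] t' ∶ M
e-root (root-e _ _ S _ i val ncx ncv x∉v fresh) = e-root-expand S fresh (exp-core i val ncx ncv x∉v)

m-expand : ∀ {t s} → t →m-need s → ∀ {Γ m e M} → Γ ⊢[ m , e ] s ∶ M → Γ ⊢[ suc m , e ] t ∶ M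
m-expand (_ , i , _ , _ , Eq.refl , Eq.refl , step) = closure 1 0 (m-root step) i

e-expand : ∀ {t s} → t →e-need s → ∀ {Γ m e M} → Γ ⊢[ m , e ] s ∶ M → Γ ⊢[ m , suc e ] t ∶ M
e-expand (_ , i , _ , _ , Eq.refl , Eq.refl , step) = closure 0 1 (e-root step) i

proposition13 : ∀ {Γ : Ctx} {m e : ℕ} {s : Term} {M : MType}
    → Γ ⊢[ m , e ] s ∶ M
    → M ≢ 𝟎
    → (∀ t → t →m-need s → Γ ⊢[ suc m , e ] t ∶ M)
      × (∀ t → t →e-need s → Γ ⊢[ m , suc e ] t ∶ M)
proposition13 D _ = (λ _ step → m-expand step D) , (λ _ step → e-expand step D)
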